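{- Let $n\ge3$, let $C_n$ and $C_{n+1}$ be the cycles on $n$ and $n+1$ vertices, and let $W_{n+1}$ be the wheel graph obtained from $C_n$ by adding a new vertex adjacent to all vertices of $C_n$. Then $\max\{t(1,n)+1,\ t(C_n),\ t(C_{n+1})\}\le t(W_{n+1})\le t(C_n)+1$.
   Context: For a finite simple graph $G$, a $G$-CFF$(t,|V(G)|)$ is a family of subsets $B_v\subseteq[1,t]=\{1,\dots,t\}$, one for each vertex $v$, such that for every edge $\{a,b\}$: (i) $B_a\not\subseteq B_b$ and $B_b\not\subseteq B_a$, and (ii) for every vertex $w\notin\{a,b\}$, $B_w\not\subseteq B_a\cup B_b$. $t(G)$ is the minimum $t$ for which a $G$-CFF$(t,|V(G)|)$ exists. $t(1,n)$ is the minimum $t$ such that there exist $n$ subsets of $[1,t]$ none contained in another; equivalently $t(1,n)=\min\{t:\binom{t}{\lfloor t/2\rfloor}\ge n\}$. -}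

module Defs where

open import Data.Nat using (ℕ; zero; suc; _≤_)
open import Data.Fin using (Fin; toℕ) renaming (zero to fzero; suc to fsuc)
open import Data.Fin.Subset using (Subset; _⊆_; _∪_)
open import Data.Product using (Σ; _×_)
open import Data.Sum using (_⊎_)
open import Data.Empty using (⊥)
open import Data.Unit using (⊤)
open import Relation.Nullary using (¬_)
open import Relation.Binary.PropositionalEquality using (_≡_; _≢_)

Graph : ℕ → Set₁
Graph n = Fin n → Fin n → Set

IsGCFF : {n : ℕ} → Graph n → (t : ℕ) → (Fin n → Subset t) → Set
IsGCFF {n} G t B =
  (a b : Fin n) → G a b →
    (¬ (B a ⊆ B b)) × (¬ (B b ⊆ B a)) ×
    ((w : Fin n) → w ≢ a → w ≢ b → ¬ (B w ⊆ (B a ∪ B b)))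

HasGCFF : {n : ℕ} → Graph n → ℕ → Set
HasGCFF {n} G t = Σ (Fin n → Subset t) (IsGCFF G t)

IsTG : {n : ℕ} → Graph n → ℕ → Set
IsTG G t = HasGCFF G t × ((s : ℕ) → HasGCFF G s → t ≤ s)

HasAntichain : ℕ → ℕ → Set
HasAntichain n t =
  Σ (Fin n → Subset t) λ B → (i j : Fin n) → i ≢ j → ¬ (B i ⊆ B j)

IsT1 : ℕ → ℕ → Set
IsT1 n t = HasAntichain n t × ((s : ℕ) → HasAntichain n s → t ≤ s)

CycleStep : (n : ℕ) → Fin n → Fin n → Set
CycleStep n i j = (suc (toℕ i) ≡ toℕ j) ⊎ ((suc (toℕ i) ≡ n) × (toℕ j ≡ 0))

Cycle : (n : ℕ) → Graph n
Cycle n i j = CycleStep n i j ⊎ CycleStep n j i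

Wheel : (n : ℕ) → Graph (suc n)
Wheel n fzero    fzero    = ⊥
Wheel n fzero    (fsuc j) = ⊤
Wheel n (fsuc i) fzero    = ⊤
Wheel n (fsuc i) (fsuc j) = Cycle n i j

-- Upper bound: give the hub of W_{n+1} a fresh point as its set and keep a C_n-CFF on the rim;
-- since every vertex of C_n has a neighbour, the rim sets form a nonempty antichain, which is
-- all the spokes need. Lower bounds: the rim of a W_{n+1}-CFF is a C_n-CFF, the wheel contains
-- C_{n+1} through the hub, and deleting one point of the hub's set leaves an antichain on the
-- rim because condition (ii) on the spokes says no rim set is covered by the hub's set together
-- with another rim set.
module Submission where

open import Defs
open import Data.Nat using (ℕ; zero; suc; _≤_; _<_; _⊔_; s≤s)
open import Data.Nat.Properties using (⊔-lub)
import Data.Nat.Properties as ℕ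
open import Data.Fin using (Fin; punchOut) renaming (zero to fzero; suc to fsuc)
open import Data.Fin.Properties using (_≟_; suc-injective)
open import Data.Fin.Subset using (Subset; _⊆_; _∪_; _∈_; inside; outside; Nonempty) renaming (⊥ to ∅)
open import Data.Fin.Subset.Properties
  using (drop-∷-⊆; ⊆-reflexive; ⊥⊆; p⊆p∪q; x∈p∪q⁺; ∪-identityˡ; ∪-identityʳ; Empty-unique; nonempty?)
open import Data.Vec using (_∷_; removeAt; here)
open import Data.Vec.Properties using (removeAt-punchOut; []=⇒lookup; lookup⇒[]=)
open import Data.Product using (Σ; ∃; _×_; _,_; proj₁; proj₂; map₂)
open import Data.Sum using (inj₁; inj₂) renaming (map to ⊎-map)
open import Data.Empty using (⊥)
open import Data.Unit using (⊤; tt)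
open import Function using (_∘_; id; _⇔_; mk⇔; Injective)
open import Function.Bundles using (module Equivalence)
open import Relation.Nullary using (¬_; yes; no; contradiction)
open import Relation.Nullary.Decidable using (decidable-stable)
open import Relation.Binary.PropositionalEquality using (_≡_; _≢_; refl; sym; trans; cong; subst)

IsGCFF-comap : ∀ {m n t} {H : Graph m} {G : Graph n} {B : Fin n → Subset t}
               (f : Fin m → Fin n) → Injective _≡_ _≡_ f → (∀ {a b} → H a b → G (f a) (f b)) →
               IsGCFF G t B → IsGCFF H t (B ∘ f)
IsGCFF-comap f f-inj hom cff a b e with cff (f a) (f b) (hom e)
... | a⊈b , b⊈a , cover-free = a⊈b , b⊈a , λ w w≢a w≢b → cover-free (f w) (w≢a ∘ f-inj) (w≢b ∘ f-inj)

Cone : ∀ {n} → Graph n → Graph (suc n)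
Cone G fzero    fzero    = ⊥
Cone G fzero    (fsuc j) = ⊤
Cone G (fsuc i) fzero    = ⊤
Cone G (fsuc i) (fsuc j) = G i j

Wheel⇔Cone-Cycle : ∀ {n} (a b : Fin (suc n)) → Wheel n a b ⇔ Cone (Cycle n) a b
Wheel⇔Cone-Cycle fzero    fzero    = mk⇔ id id
Wheel⇔Cone-Cycle fzero    (fsuc _) = mk⇔ id id
Wheel⇔Cone-Cycle (fsuc _) fzero    = mk⇔ id id
Wheel⇔Cone-Cycle (fsuc _) (fsuc _) = mk⇔ id id

IsGCFF-Cone⇒IsGCFF : ∀ {n t} {G : Graph n} {B : Fin (suc n) → Subset t} →
                     IsGCFF (Cone G) t B → IsGCFF G t (B ∘ fsuc)
IsGCFF-Cone⇒IsGCFF = IsGCFF-comap fsuc suc-injective id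

coneFamily : ∀ {n t} → (Fin n → Subset t) → Fin (suc n) → Subset (suc t)
coneFamily B fzero    = inside ∷ ∅
coneFamily B (fsuc i) = outside ∷ B i

module _ {n t} {G : Graph n} {B : Fin n → Subset t}
         (cff : IsGCFF G t B) (neighbour : (i : Fin n) → ∃ (G i)) where

  IsGCFF⇒antichain : ∀ {w i} → w ≢ i → ¬ B w ⊆ B i
  IsGCFF⇒antichain {w} {i} w≢i w⊆i with neighbour i
  ... | j , i~j with w ≟ j
  ... | yes refl = proj₁ (proj₂ (cff i j i~j)) w⊆i
  ... | no w≢j = proj₂ (proj₂ (cff i j i~j)) w w≢i w≢j (p⊆p∪q (B j) ∘ w⊆i)

  IsGCFF⇒nonempty : ∀ i → ¬ B i ⊆ ∅
  IsGCFF⇒nonempty i i⊆∅ with neighbour i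
  ... | j , i~j = proj₁ (cff i j i~j) (⊥⊆ ∘ i⊆∅)

  private
    hub⊈rim : ∀ {q : Subset t} → ¬ (inside ∷ ∅) ⊆ (outside ∷ q)
    hub⊈rim hub⊆rim with hub⊆rim here
    ... | ()

    rim⊈hub : ∀ j → ¬ (outside ∷ B j) ⊆ (inside ∷ ∅)
    rim⊈hub j = IsGCFF⇒nonempty j ∘ drop-∷-⊆

    rim⊈ : ∀ {k j c} {q : Subset t} → k ≢ j → q ⊆ B j → ¬ (outside ∷ B k) ⊆ (c ∷ q)
    rim⊈ k≢j q⊆j k⊆q = IsGCFF⇒antichain k≢j (q⊆j ∘ drop-∷-⊆ k⊆q)

  IsGCFF-Cone : IsGCFF (Cone G) (suc t) (coneFamily B)
  IsGCFF-Cone fzero    fzero    ()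
  IsGCFF-Cone fzero    (fsuc j) _ = hub⊈rim , rim⊈hub j , cover-free
    where
    cover-free : ∀ w → w ≢ fzero → w ≢ fsuc j → ¬ coneFamily B w ⊆ (inside ∷ (∅ ∪ B j))
    cover-free fzero    w≢0 _   = contradiction refl w≢0
    cover-free (fsuc k) _   k≢j = rim⊈ (k≢j ∘ cong fsuc) (⊆-reflexive (∪-identityˡ (B j)))
  IsGCFF-Cone (fsuc i) fzero    _ = rim⊈hub i , hub⊈rim , cover-free
    where
    cover-free : ∀ w → w ≢ fsuc i → w ≢ fzero → ¬ coneFamily B w ⊆ (inside ∷ (B i ∪ ∅))
    cover-free fzero    _   w≢0 = contradiction refl w≢0
    cover-free (fsuc k) k≢i _   = rim⊈ (k≢i ∘ cong fsuc) (⊆-reflexive (∪-identityʳ (B i)))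
  IsGCFF-Cone (fsuc i) (fsuc j) i~j with cff i j i~j
  ... | i⊈j , j⊈i , cover-free = i⊈j ∘ drop-∷-⊆ , j⊈i ∘ drop-∷-⊆ , cover-free′
    where
    cover-free′ : ∀ w → w ≢ fsuc i → w ≢ fsuc j → ¬ coneFamily B w ⊆ (outside ∷ (B i ∪ B j))
    cover-free′ fzero    _   _   = hub⊈rim
    cover-free′ (fsuc k) k≢i k≢j = cover-free k (k≢i ∘ cong fsuc) (k≢j ∘ cong fsuc) ∘ drop-∷-⊆

cycle-successor : ∀ m (i : Fin (suc m)) → ∃ (CycleStep (suc m) i)
cycle-successor zero    fzero    = fzero , inj₂ (refl , refl)
cycle-successor (suc m) fzero    = fsuc fzero , inj₁ refl
cycle-successor (suc m) (fsuc i) with cycle-successor m i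
... | j , inj₁ 1+i≡j         = fsuc j , inj₁ (cong suc 1+i≡j)
... | _ , inj₂ (1+i≡m , _)   = fzero , inj₂ (cong suc 1+i≡m , refl)

cycle-neighbour : ∀ {n} (i : Fin n) → ∃ (Cycle n i)
cycle-neighbour {suc m} i = map₂ inj₁ (cycle-successor m i)

CycleStep-pred : ∀ {n} {i j : Fin n} → CycleStep (suc n) (fsuc i) (fsuc j) → CycleStep n i j
CycleStep-pred (inj₁ 2+i≡1+j) = inj₁ (ℕ.suc-injective 2+i≡1+j)
CycleStep-pred (inj₂ (_ , ()))

-- The vertex 0 of C_{n+1} plays the hub: its two cycle edges are spokes of the wheel.
Cycle⇒Wheel : ∀ {m} {a b : Fin (suc (suc m))} → Cycle (suc (suc m)) a b → Wheel (suc m) a b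
Cycle⇒Wheel {a = fzero}  {fzero}  (inj₁ (inj₁ ()))
Cycle⇒Wheel {a = fzero}  {fzero}  (inj₁ (inj₂ (() , _)))
Cycle⇒Wheel {a = fzero}  {fzero}  (inj₂ (inj₁ ()))
Cycle⇒Wheel {a = fzero}  {fzero}  (inj₂ (inj₂ (() , _)))
Cycle⇒Wheel {a = fzero}  {fsuc _} _ = tt
Cycle⇒Wheel {a = fsuc _} {fzero}  _ = tt
Cycle⇒Wheel {a = fsuc _} {fsuc _} e = ⊎-map CycleStep-pred CycleStep-pred e

module _ {s} (p : Subset (suc s)) {x z : Fin (suc s)} (x≢z : x ≢ z) where

  ∈-removeAt⁺ : z ∈ p → punchOut x≢z ∈ removeAt p x
  ∈-removeAt⁺ z∈p = lookup⇒[]= _ _ (trans (removeAt-punchOut p x≢z) ([]=⇒lookup z∈p))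

  ∈-removeAt⁻ : punchOut x≢z ∈ removeAt p x → z ∈ p
  ∈-removeAt⁻ z∈p-x = lookup⇒[]= _ _ (trans (sym (removeAt-punchOut p x≢z)) ([]=⇒lookup z∈p-x))

removeAt-⊆⇒⊆-∪ : ∀ {s} {p q r : Subset (suc s)} {x} → x ∈ r →
                 removeAt p x ⊆ removeAt q x → p ⊆ r ∪ q
removeAt-⊆⇒⊆-∪ {x = x} x∈r p-x⊆q-x {z} z∈p with x ≟ z
... | yes refl = x∈p∪q⁺ (inj₁ x∈r)
... | no x≢z   = x∈p∪q⁺ (inj₂ (∈-removeAt⁻ _ x≢z (p-x⊆q-x (∈-removeAt⁺ _ x≢z z∈p))))

removeAt-antichain : ∀ {n s} (C : Fin n → Subset (suc s)) {r : Subset (suc s)} {x} → x ∈ r →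
                     (∀ i j → i ≢ j → ¬ C i ⊆ r ∪ C j) → HasAntichain n s
removeAt-antichain C {x = x} x∈r i⊈r∪j =
  (λ i → removeAt (C i) x) , λ i j i≢j → i⊈r∪j i j i≢j ∘ removeAt-⊆⇒⊆-∪ x∈r

IsGCFF-Cone⇒hub-nonempty : ∀ {m t} {G : Graph (suc m)} {B : Fin (suc (suc m)) → Subset t} →
                           IsGCFF (Cone G) t B → Nonempty (B fzero)
IsGCFF-Cone⇒hub-nonempty {B = B} cff = decidable-stable (nonempty? (B fzero)) λ hub-empty →
  proj₁ (cff fzero (fsuc fzero) tt) (subst (_⊆ B (fsuc fzero)) (sym (Empty-unique hub-empty)) ⊥⊆)

IsGCFF-Cone⇒antichain : ∀ {m t} {G : Graph (suc m)} {B : Fin (suc (suc m)) → Subset t} →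
                        IsGCFF (Cone G) t B → Σ ℕ λ s → t ≡ suc s × HasAntichain (suc m) s
IsGCFF-Cone⇒antichain cff with IsGCFF-Cone⇒hub-nonempty cff
IsGCFF-Cone⇒antichain {t = suc s} {B = B} cff | _ , x∈hub =
  s , refl , removeAt-antichain (B ∘ fsuc) x∈hub λ i j i≢j →
    proj₂ (proj₂ (cff fzero (fsuc j) tt)) (fsuc i) (λ ()) (i≢j ∘ suc-injective)

IsT1<IsGCFF-Cone : ∀ {m t1 t} {G : Graph (suc m)} {B : Fin (suc (suc m)) → Subset t} →
                   IsT1 (suc m) t1 → IsGCFF (Cone G) t B → t1 < t
IsT1<IsGCFF-Cone (_ , t1-min) cff with IsGCFF-Cone⇒antichain cff
... | s , refl , antichain = s≤s (t1-min s antichain)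

corollary6p19 : (n : ℕ) → 3 ≤ n →
    (t1 tC tC′ tW : ℕ) →
    IsT1 n t1 → IsTG (Cycle n) tC → IsTG (Cycle (suc n)) tC′ → IsTG (Wheel n) tW →
    ((suc t1 ⊔ tC) ⊔ tC′ ≤ tW) × (tW ≤ suc tC)
corollary6p19 zero ()
corollary6p19 n@(suc m) _ t1 tC tC′ tW t1-spec ((Bc , Bc-cff) , tC-min) (_ , tC′-min) ((Bw , Bw-cff) , tW-min) =
  ⊔-lub (⊔-lub t1<tW tC≤tW) tC′≤tW , tW≤1+tC
  where
  Bw-cone : IsGCFF (Cone (Cycle n)) tW Bw
  Bw-cone = IsGCFF-comap id id (Equivalence.from (Wheel⇔Cone-Cycle _ _)) Bw-cff

  t1<tW : t1 < tW
  t1<tW = IsT1<IsGCFF-Cone t1-spec Bw-cone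

  tC≤tW : tC ≤ tW
  tC≤tW = tC-min tW (Bw ∘ fsuc , IsGCFF-Cone⇒IsGCFF Bw-cone)

  tC′≤tW : tC′ ≤ tW
  tC′≤tW = tC′-min tW (Bw , IsGCFF-comap id id Cycle⇒Wheel Bw-cff)

  tW≤1+tC : tW ≤ suc tC
  tW≤1+tC = tW-min (suc tC)
    (coneFamily Bc , IsGCFF-comap id id (Equivalence.to (Wheel⇔Cone-Cycle _ _))
                                        (IsGCFF-Cone Bc-cff cycle-neighbour))
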